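{- Let $(G,+)$ be a group (not necessarily commutative), let $I[1],\dots,I[N]$ ($N\ge 1$) be elements of $G$, and let $A$ be the array obtained from $I$ by the Southwest Tree build procedure described in the context. Let $1\le i\le N$ and $\delta\in G$, and let $I'$ be the array with $I'[j]=I[j]$ for $j\ne i$ and $I'[i]=I[i]+\delta$. Then after executing the procedure $\texttt{update}(i,\delta)$ described in the context on $A$, the array $A$ coincides with the array obtained from $I'$ by the Southwest Tree build procedure (with all sums taken in the stated order). In particular, subsequent accumulations reflect the modified value $I[i]+\delta$.
   Context: Southwest Tree index structure: let $h_r=\lfloor \log_2 N\rfloor+1$. Define a full binary tree whose nodes are labelled by indices as follows: the root has index $2^{h_r}-1$ and height $h_r$; a node with index $i$ and height $h>1$ has left child with index $i-2^{h-1}$ and right child with index $i-1$, both of height $h-1$; nodes of height $1$ are leaves. Every index in $\{1,\dots,2^{h_r}-1\}$ occurs as exactly one node. Indices greater than $N$ are "phantom" nodes storing no value. Build procedure: initially $A[j]=I[j]$ for $1\le j\le N$. The tree is traversed depth-first in post-order; when visiting a node of index $c\le N$ with height $h>1$, set $A[c] := A[c-2^{h-1}] + A[c-1] + A[c]$ (in this order); phantom nodes and leaves are unchanged. Update procedure: $\texttt{update}(i,\delta)=\mathrm{upd}(i,\delta,\,2^{h_r}-1,\,2^{h_r-1})$, where $\mathrm{upd}(i,\delta,c,\ell)$ is defined recursively: if $c=i$, set $A[i]:=A[i]+\delta$ and stop; otherwise, (1) if $c\le N$, set $A[c]:=(-A[c-1])+(-A[c-\ell])+A[c]$, where $-x$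 denotes the group inverse of $x$; (2) let $c'=c-\ell$ if $i\le c-\ell$ and $c'=c-1$ otherwise, and call $\mathrm{upd}(i,\delta,c',\ell/2)$; (3) if $c\le N$, set $A[c]:=A[c-\ell]+A[c-1]+A[c]$. The operation $+$ may be non-commutative; all sums are taken in the stated order. -}

module Defs where

open import Level using (Level)
open import Algebra.Bundles using (Group)
open import Data.Nat using (ℕ; zero; suc; _+_; _∸_; _^_; _≡ᵇ_; _≤ᵇ_)
open import Data.Nat.Logarithm using (⌊log₂_⌋)
open import Data.Bool using (if_then_else_; true; false)

module SouthwestTree {c ℓ : Level} (G : Group c ℓ) where
  open Group G

  -- Arrays are modelled as functions ℕ → Carrier; only indices 1..N are meaningful.
  Array : Set c
  Array = ℕ → Carrier

  set : Array → ℕ → Carrier → Array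
  set A k x j = if j ≡ᵇ k then x else A j

  rootHeight : ℕ → ℕ
  rootHeight N = ⌊log₂ N ⌋ + 1

  rootIndex : ℕ → ℕ
  rootIndex N = 2 ^ rootHeight N ∸ 1

  buildNode : ℕ → ℕ → ℕ → Array → Array
  buildNode N zero c A = A
  buildNode N (suc zero) c A = A
  buildNode N (suc (suc k)) c A =
    let A₁ = buildNode N (suc k) (c ∸ 2 ^ suc k) A
        A₂ = buildNode N (suc k) (c ∸ 1) A₁
    in if c ≤ᵇ N
       then set A₂ c ((A₂ (c ∸ 2 ^ suc k) ∙ A₂ (c ∸ 1)) ∙ A₂ c)
       else A₂

  build : ℕ → Array → Array
  build N I = buildNode N (rootHeight N) (rootIndex N) I

  -- upd(i, δ, c, ℓ) with ℓ = 2^{h-1}, where h is the height of node c.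
  -- The case h = 0 is unreachable for 1 ≤ i ≤ N (i lies in the subtree of c);
  -- it returns the array unchanged.
  upd : ℕ → ℕ → Carrier → ℕ → ℕ → Array → Array
  upd N i δ h c A with c ≡ᵇ i
  ... | true = set A i (A i ∙ δ)
  upd N i δ zero c A | false = A
  upd N i δ (suc h) c A | false =
    let l  = 2 ^ h
        A₁ = if c ≤ᵇ N then set A c (((A (c ∸ 1)) ⁻¹ ∙ (A (c ∸ l)) ⁻¹) ∙ A c) else A
        c′ = if i ≤ᵇ c ∸ l then c ∸ l else c ∸ 1
        A₂ = upd N i δ h c′ A₁
    in if c ≤ᵇ N then set A₂ c ((A₂ (c ∸ l) ∙ A₂ (c ∸ 1)) ∙ A₂ c) else A₂

  update : ℕ → ℕ → Carrier → Array → Array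
  update N i δ A = upd N i δ (rootHeight N) (rootIndex N) A

  modify : Array → ℕ → Carrier → Array
  modify I i δ = set I i (I i ∙ δ)

-- A subtree of height h occupying the indices b + 1, …, b + 2^h − 1 has its root at the largest
-- of them, and its two children occupy the lower and the upper half of the others.  Building a
-- subtree writes only inside it, and what it leaves at an index of the subtree depends only on the
-- input there.  On its way to i, upd first strips the children's contributions from each ancestor
-- c: since A[c] = (A[l] + A[r]) + I[c] and (−A[r]) + (−A[l]) = −(A[l] + A[r]), this recovers I[c]
-- even in a non-commutative group.  It then recurses into the child containing i and accumulates
-- again from the updated children; at i itself, associativity gives
-- ((A[l] + A[r]) + I[i]) + δ = (A[l] + A[r]) + (I[i] + δ).  Induction on the height, comparing
-- arrays only on the indices of the current subtree, proves the claim.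

{-# OPTIONS --safe #-}
module Submission where

open import Level using (Level; _⊔_)
open import Algebra.Bundles using (Group)
open import Data.Bool using (true; false; if_then_else_)
open import Data.Bool.Properties using (T-≡; ¬-not)
open import Data.Empty using (⊥-elim)
open import Data.Nat using (ℕ; zero; suc; _+_; _∸_; _^_; _≤_; _<_; _≡ᵇ_; _≤ᵇ_; s≤s)
open import Data.Nat.Properties
open import Data.Nat.Logarithm using (⌊log₂_⌋; ⌊log₂⌋-mono-≤; ⌊log₂[2^n]⌋≡n)
open import Function.Bundles using (Equivalence)
open import Relation.Nullary using (¬_; yes; no)
import Relation.Binary.PropositionalEquality as ≡
open ≡ using (_≡_; _≢_)
open import Defs

≡ᵇ-refl : ∀ n → (n ≡ᵇ n) ≡ true
≡ᵇ-refl n = Equivalence.to T-≡ (≡⇒≡ᵇ n n ≡.refl)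

≢⇒≡ᵇ≡false : ∀ {m n} → m ≢ n → (m ≡ᵇ n) ≡ false
≢⇒≡ᵇ≡false {m} {n} m≢n = ¬-not (λ eq → m≢n (≡ᵇ⇒≡ m n (Equivalence.from T-≡ eq)))

≤⇒≤ᵇ≡true : ∀ {m n} → m ≤ n → (m ≤ᵇ n) ≡ true
≤⇒≤ᵇ≡true m≤n = Equivalence.to T-≡ (≤⇒≤ᵇ m≤n)

>⇒≤ᵇ≡false : ∀ {m n} → n < m → (m ≤ᵇ n) ≡ false
>⇒≤ᵇ≡false {m} {n} n<m = ¬-not (λ eq → <⇒≱ n<m (≤ᵇ⇒≤ m n (Equivalence.from T-≡ eq)))

treeSize : ℕ → ℕ
treeSize zero    = zero
treeSize (suc h) = suc (treeSize h + treeSize h)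

2^h≡1+treeSize : ∀ h → 2 ^ h ≡ suc (treeSize h)
2^h≡1+treeSize zero = ≡.refl
2^h≡1+treeSize (suc h) rewrite 2^h≡1+treeSize h | +-identityʳ (treeSize h) =
  ≡.cong suc (+-suc (treeSize h) (treeSize h))

-- top b h is the root index of the subtree of height h occupying the indices b + 1, …, top b h;
-- its left and right subtrees are those of height h − 1 above the bases b and top b (h − 1).
top : ℕ → ℕ → ℕ
top b h = b + treeSize h

top-suc : ∀ b h → top b (suc h) ≡ suc (top (top b h) h)
top-suc b h = ≡.trans (+-suc b _) (≡.cong suc (≡.sym (+-assoc b (treeSize h) (treeSize h))))

top-suc∸2^ : ∀ b h → top b (suc h) ∸ 2 ^ h ≡ top b h
top-suc∸2^ b h =
  ≡.trans (≡.cong₂ _∸_ (top-suc b h) (2^h≡1+treeSize h)) (m+n∸n≡m (top b h) (treeSize h))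

top-suc∸1 : ∀ b h → top b (suc h) ∸ 1 ≡ top (top b h) h
top-suc∸1 b h = ≡.cong (_∸ 1) (top-suc b h)

record InTree (b h j : ℕ) : Set where
  constructor inTree
  field
    lower : b < j
    upper : j ≤ top b h

InTree-zero : ∀ {b j} → ¬ InTree b 0 j
InTree-zero {b} (inTree b<j j≤b) = <⇒≱ b<j (≡.subst (_ ≤_) (+-identityʳ b) j≤b)

rightRoot<root : ∀ b h → top (top b h) h < top b (suc h)
rightRoot<root b h = ≡.subst (top (top b h) h <_) (≡.sym (top-suc b h)) (n<1+n _)

leftRoot<root : ∀ b h → top b h < top b (suc h)
leftRoot<root b h = ≤-<-trans (m≤m+n _ _) (rightRoot<root b h)

left<root : ∀ {b h j} → InTree b h j → j < top b (suc h)
left<root {b} {h} p = ≤-<-trans (InTree.upper p) (leftRoot<root b h)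

right<root : ∀ {b h j} → InTree (top b h) h j → j < top b (suc h)
right<root {b} {h} q = ≤-<-trans (InTree.upper q) (rightRoot<root b h)

InTree-left : ∀ {b h j} → InTree b h j → InTree b (suc h) j
InTree-left p = inTree (InTree.lower p) (<⇒≤ (left<root p))

InTree-right : ∀ {b h j} → InTree (top b h) h j → InTree b (suc h) j
InTree-right {b} q = inTree (≤-<-trans (m≤m+n b _) (InTree.lower q)) (<⇒≤ (right<root q))

InTree-root : ∀ {b h} → InTree b (suc h) (top b (suc h))
InTree-root {b} {h} = inTree (≤-<-trans (m≤m+n b _) (leftRoot<root b h)) ≤-refl

InTree-leftRoot : ∀ b k → InTree b (suc (suc k)) (top b (suc k))
InTree-leftRoot b k = InTree-left (InTree-root {b} {k})

InTree-rightRoot : ∀ b k → InTree b (suc (suc k)) (top (top b (suc k)) (suc k))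
InTree-rightRoot b k = InTree-right (InTree-root {top b (suc k)} {k})

left∩right : ∀ {b h j} → InTree b h j → ¬ InTree (top b h) h j
left∩right p q = <⇒≱ (InTree.lower q) (InTree.upper p)

root∉left : ∀ {b h} → ¬ InTree b h (top b (suc h))
root∉left p = n≮n _ (left<root p)

root∉right : ∀ {b h} → ¬ InTree (top b h) h (top b (suc h))
root∉right q = n≮n _ (right<root q)

∉⇒≢root : ∀ {b h j} → ¬ InTree b (suc h) j → j ≢ top b (suc h)
∉⇒≢root j∉ ≡.refl = j∉ InTree-root

data Position (b h j : ℕ) : Set where
  inLeft  : InTree b h j → Position b h j
  inRight : InTree (top b h) h j → Position b h j
  atRoot  : j ≡ top b (suc h) → Position b h j

position : ∀ {b h j} → InTree b (suc h) j → Position b h j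
position {b} {h} {j} (inTree b<j j≤c) with j ≤? top b h
... | yes j≤l = inLeft (inTree b<j j≤l)
... | no j≰l with j ≤? top (top b h) h
...   | yes j≤r = inRight (inTree (≰⇒> j≰l) j≤r)
...   | no j≰r  = atRoot (≤-antisym j≤c (≡.subst (_≤ j) (≡.sym (top-suc b h)) (≰⇒> j≰r)))

2^h∸1≡treeSize : ∀ h → 2 ^ h ∸ 1 ≡ treeSize h
2^h∸1≡treeSize h = ≡.cong (_∸ 1) (2^h≡1+treeSize h)

<2^⌊log₂⌋+1 : ∀ n → n < 2 ^ (⌊log₂ n ⌋ + 1)
<2^⌊log₂⌋+1 n = ≰⇒> λ 2^h≤n →
  m+1+n≰m ⌊log₂ n ⌋ (≡.subst (_≤ ⌊log₂ n ⌋) (⌊log₂[2^n]⌋≡n (⌊log₂ n ⌋ + 1)) (⌊log₂⌋-mono-≤ 2^h≤n))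

InTree-log₂ : ∀ {n j} → 1 ≤ j → j ≤ n → InTree 0 (⌊log₂ n ⌋ + 1) j
InTree-log₂ {n} 1≤j j≤n =
  inTree 1≤j (≤-pred (≤-trans (s≤s j≤n) (≡.subst (n <_) (2^h≡1+treeSize _) (<2^⌊log₂⌋+1 n))))

module SouthwestTreeUpdate {a ℓ : Level} (G : Group a ℓ) (N : ℕ) where
  open Group G
  open SouthwestTree G
  open import Algebra.Properties.Group G using (⁻¹-anti-homo-∙; \\-leftDividesʳ)
  open import Relation.Binary.Reasoning.Setoid setoid

  infix 4 _≈[_]_
  _≈[_]_ : Array → (ℕ → Set) → Array → Set ℓ
  A ≈[ P ] B = ∀ {j} → P j → A j ≈ B j

  set-≡ : ∀ A k x → set A k x k ≡ x
  set-≡ A k x rewrite ≡ᵇ-refl k = ≡.refl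

  set-≢ : ∀ A k x {j} → j ≢ k → set A k x j ≡ A j
  set-≢ A k x j≢k rewrite ≢⇒≡ᵇ≡false j≢k = ≡.refl

  set-cong : ∀ {P A B k x y} → x ≈ y → A ≈[ P ] B → set A k x ≈[ P ] set B k y
  set-cong {A = A} {B} {k} {x} {y} x≈y A≈B {j} p with j ≟ k
  ... | yes ≡.refl = trans (reflexive (set-≡ A j x)) (trans x≈y (sym (reflexive (set-≡ B j y))))
  ... | no j≢k     = trans (reflexive (set-≢ A k x j≢k)) (trans (A≈B p) (sym (reflexive (set-≢ B k y j≢k))))

  modify-cong : ∀ {b h A B i δ} → InTree b h i → A ≈[ InTree b h ] B →
                modify A i δ ≈[ InTree b h ] modify B i δ
  modify-cong {A = A} {B} {i} i∈ A≈B = set-cong {A = A} {B} {i} (∙-congʳ (A≈B i∈)) A≈B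

  modify-outside : ∀ {b h B i δ} → ¬ InTree b h i → modify B i δ ≈[ InTree b h ] B
  modify-outside {b} {h} {B} i∉ p =
    reflexive (set-≢ B _ _ (λ j≡i → i∉ (≡.subst (InTree b h) j≡i p)))

  accumulate : ℕ → ℕ → ℕ → Array → Array
  accumulate l r c A = if c ≤ᵇ N then set A c ((A l ∙ A r) ∙ A c) else A

  unaccumulate : ℕ → ℕ → ℕ → Array → Array
  unaccumulate l r c A = if c ≤ᵇ N then set A c ((A r ⁻¹ ∙ A l ⁻¹) ∙ A c) else A

  accumulate-≢ : ∀ l r {c} A {j} → j ≢ c → accumulate l r c A j ≡ A j
  accumulate-≢ l r {c} A j≢c with c ≤ᵇ N
  ... | true  = set-≢ A c _ j≢c
  ... | false = ≡.refl

  unaccumulate-≢ : ∀ l r {c} A {j} → j ≢ c → unaccumulate l r c A j ≡ A j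
  unaccumulate-≢ l r {c} A j≢c with c ≤ᵇ N
  ... | true  = set-≢ A c _ j≢c
  ... | false = ≡.refl

  accumulate-cong : ∀ {P l r c A B} → P l → P r → P c → A ≈[ P ] B →
                    accumulate l r c A ≈[ P ] accumulate l r c B
  accumulate-cong {c = c} {A} {B} l∈ r∈ c∈ A≈B with c ≤ᵇ N
  ... | true  = set-cong {A = A} {B} {c} (∙-cong (∙-cong (A≈B l∈) (A≈B r∈)) (A≈B c∈)) A≈B
  ... | false = A≈B

  unaccumulate-accumulate : ∀ {P l r c A X} → l ≢ c → r ≢ c → P l → P r → P c →
                            A ≈[ P ] accumulate l r c X → unaccumulate l r c A ≈[ P ] X
  unaccumulate-accumulate {P} {l} {r} {c} {A} {X} l≢c r≢c l∈ r∈ c∈ A≈ with c ≤ᵇ N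
  ... | false = A≈
  ... | true  = agree
    where
    A≈X : ∀ {j} → j ≢ c → P j → A j ≈ X j
    A≈X j≢c p = trans (A≈ p) (reflexive (set-≢ X c _ j≢c))

    agree : set A c ((A r ⁻¹ ∙ A l ⁻¹) ∙ A c) ≈[ P ] X
    agree {j} p with j ≟ c
    ... | no j≢c = trans (reflexive (set-≢ A c _ j≢c)) (A≈X j≢c p)
    ... | yes ≡.refl = begin
      set A j ((A r ⁻¹ ∙ A l ⁻¹) ∙ A j) j       ≡⟨ set-≡ A j _ ⟩
      (A r ⁻¹ ∙ A l ⁻¹) ∙ A j                   ≈⟨ ∙-cong (∙-cong (⁻¹-cong (A≈X r≢c r∈))
                                                                   (⁻¹-cong (A≈X l≢c l∈)))
                                                          (trans (A≈ p) (reflexive (set-≡ X j _))) ⟩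
      (X r ⁻¹ ∙ X l ⁻¹) ∙ ((X l ∙ X r) ∙ X j)   ≈⟨ ∙-congʳ (⁻¹-anti-homo-∙ (X l) (X r)) ⟨
      (X l ∙ X r) ⁻¹ ∙ ((X l ∙ X r) ∙ X j)      ≈⟨ \\-leftDividesʳ (X l ∙ X r) (X j) ⟩
      X j                                       ∎

  accumulate-modify : ∀ {l r c} X δ → l ≢ c → r ≢ c →
                      ∀ j → modify (accumulate l r c X) c δ j ≈ accumulate l r c (modify X c δ) j
  accumulate-modify {l} {r} {c} X δ l≢c r≢c j with c ≤ᵇ N
  ... | false = refl
  ... | true with j ≟ c
  ...   | no j≢c = begin
    modify (set X c v) c δ j   ≡⟨ set-≢ (set X c v) c _ j≢c ⟩
    set X c v j                ≡⟨ set-≢ X c v j≢c ⟩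
    X j                        ≡⟨ set-≢ X c _ j≢c ⟨
    Y j                        ≡⟨ set-≢ Y c _ j≢c ⟨
    set Y c ((Y l ∙ Y r) ∙ Y c) j   ∎
    where
    v = (X l ∙ X r) ∙ X c
    Y = modify X c δ
  ...   | yes ≡.refl = begin
    modify (set X j v) j δ j        ≡⟨ set-≡ (set X j v) j _ ⟩
    set X j v j ∙ δ                 ≡⟨ ≡.cong (_∙ δ) (set-≡ X j v) ⟩
    ((X l ∙ X r) ∙ X j) ∙ δ         ≈⟨ assoc _ _ _ ⟩
    (X l ∙ X r) ∙ (X j ∙ δ)         ≡⟨ ≡.cong₂ (λ x y → (x ∙ y) ∙ (X j ∙ δ))
                                               (set-≢ X j _ l≢c) (set-≢ X j _ r≢c) ⟨
    (Y l ∙ Y r) ∙ (X j ∙ δ)         ≡⟨ ≡.cong ((Y l ∙ Y r) ∙_) (set-≡ X j _) ⟨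
    (Y l ∙ Y r) ∙ Y j               ≡⟨ set-≡ Y j _ ⟨
    set Y j ((Y l ∙ Y r) ∙ Y j) j   ∎
    where
    v = (X l ∙ X r) ∙ X j
    Y = modify X j δ

  buildAt : ℕ → ℕ → Array → Array
  buildAt b h = buildNode N h (top b h)

  children : ℕ → ℕ → Array → Array
  children b h B = buildAt (top b h) h (buildAt b h B)

  accumulateRoot : ℕ → ℕ → Array → Array
  accumulateRoot b h = accumulate (top b h) (top (top b h) h) (top b (suc h))

  unaccumulateRoot : ℕ → ℕ → Array → Array
  unaccumulateRoot b h = unaccumulate (top b h) (top (top b h) h) (top b (suc h))

  buildAt-suc-suc : ∀ b k B →
                    buildAt b (suc (suc k)) B ≡ accumulateRoot b (suc k) (children b (suc k) B)
  buildAt-suc-suc b k B =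
    ≡.cong₂ (λ l r → accumulate l r c (buildNode N (suc k) r (buildNode N (suc k) l B)))
            (top-suc∸2^ b (suc k)) (top-suc∸1 b (suc k))
    where c = top b (suc (suc k))

  accumulateRoot-cong : ∀ {b k A B} → A ≈[ InTree b (suc (suc k)) ] B →
                        accumulateRoot b (suc k) A ≈[ InTree b (suc (suc k)) ]
                        accumulateRoot b (suc k) B
  accumulateRoot-cong {b} {k} =
    accumulate-cong (InTree-leftRoot b k) (InTree-rightRoot b k) InTree-root

  buildAt-frame : ∀ h b {B j} → ¬ InTree b h j → buildAt b h B j ≡ B j
  buildAt-frame zero          b _ = ≡.refl
  buildAt-frame (suc zero)    b _ = ≡.refl
  buildAt-frame (suc (suc k)) b {B} {j} j∉ =
    ≡.trans (≡.cong-app (buildAt-suc-suc b k B) j)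
    (≡.trans (accumulate-≢ _ _ (children b (suc k) B) (∉⇒≢root j∉))
      (≡.trans (buildAt-frame (suc k) (top b (suc k)) (λ q → j∉ (InTree-right q)))
               (buildAt-frame (suc k) b (λ p → j∉ (InTree-left p)))))

  buildAt-fixes-right : ∀ {b h B} → buildAt b h B ≈[ InTree (top b h) h ] B
  buildAt-fixes-right {b} {h} q = reflexive (buildAt-frame h b (λ p → left∩right p q))

  children-left : ∀ {b h B j} → InTree b h j → children b h B j ≡ buildAt b h B j
  children-left {b} {h} p = buildAt-frame h (top b h) (left∩right p)

  children-root : ∀ b h B → children b h B (top b (suc h)) ≡ B (top b (suc h))
  children-root b h B = ≡.trans (buildAt-frame h (top b h) root∉right) (buildAt-frame h b root∉left)

  children-cong-root : ∀ b h B B' → B (top b (suc h)) ≈ B' (top b (suc h)) →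
                       children b h B (top b (suc h)) ≈ children b h B' (top b (suc h))
  children-cong-root b h B B' B≈B' = begin
    children b h B (top b (suc h))    ≡⟨ children-root b h B ⟩
    B (top b (suc h))                 ≈⟨ B≈B' ⟩
    B' (top b (suc h))                ≡⟨ children-root b h B' ⟨
    children b h B' (top b (suc h))   ∎

  buildAt-cong : ∀ h b {B B'} → B ≈[ InTree b h ] B' → buildAt b h B ≈[ InTree b h ] buildAt b h B'

  children-cong-left : ∀ {b h B B'} → B ≈[ InTree b h ] B' →
                       children b h B ≈[ InTree b h ] children b h B'
  children-cong-left {b} {h} {B} {B'} B≈B' {j} p = begin
    children b h B j    ≡⟨ children-left p ⟩
    buildAt b h B j     ≈⟨ buildAt-cong h b B≈B' p ⟩
    buildAt b h B' j    ≡⟨ children-left p ⟨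
    children b h B' j   ∎

  children-cong-right : ∀ {b h B B'} → B ≈[ InTree (top b h) h ] B' →
                        children b h B ≈[ InTree (top b h) h ] children b h B'
  children-cong-right {b} {h} B≈B' = buildAt-cong h (top b h) λ q →
    trans (buildAt-fixes-right q) (trans (B≈B' q) (sym (buildAt-fixes-right q)))

  children-cong : ∀ {b h B B'} → B ≈[ InTree b (suc h) ] B' →
                  children b h B ≈[ InTree b (suc h) ] children b h B'
  children-cong {b} {h} {B} {B'} B≈B' p with position p
  ... | inLeft q      = children-cong-left (λ q′ → B≈B' (InTree-left q′)) q
  ... | inRight q     = children-cong-right (λ q′ → B≈B' (InTree-right q′)) q
  ... | atRoot ≡.refl = children-cong-root b h B B' (B≈B' p)

  buildAt-cong zero          b B≈B' = B≈B'
  buildAt-cong (suc zero)    b B≈B' = B≈B'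
  buildAt-cong (suc (suc k)) b {B} {B'} B≈B' {j} p = begin
    buildAt b (suc (suc k)) B j                          ≡⟨ ≡.cong-app (buildAt-suc-suc b k B) j ⟩
    accumulateRoot b (suc k) (children b (suc k) B) j    ≈⟨ accumulateRoot-cong {b} {k} (children-cong B≈B') p ⟩
    accumulateRoot b (suc k) (children b (suc k) B') j   ≡⟨ ≡.cong-app (buildAt-suc-suc b k B') j ⟨
    buildAt b (suc (suc k)) B' j                         ∎

  unaccumulateRoot-buildAt : ∀ {b k A B} →
                             A ≈[ InTree b (suc (suc k)) ] buildAt b (suc (suc k)) B →
                             unaccumulateRoot b (suc k) A ≈[ InTree b (suc (suc k)) ] children b (suc k) B
  unaccumulateRoot-buildAt {b} {k} {A} {B} A≈ =
    unaccumulate-accumulate {l = top b (suc k)} {top (top b (suc k)) (suc k)} {top b (suc (suc k))}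
                            {A} {children b (suc k) B}
                            (<⇒≢ (leftRoot<root b (suc k))) (<⇒≢ (rightRoot<root b (suc k)))
                            (InTree-leftRoot b k) (InTree-rightRoot b k) InTree-root
                            (λ p → trans (A≈ p) (reflexive (≡.cong-app (buildAt-suc-suc b k B) _)))

  module _ (δ : Carrier) where

    updAt : ℕ → ℕ → ℕ → Array → Array
    updAt i b h = upd N i δ h (top b h)

    updAt-root : ∀ b h A → updAt (top b h) b h A ≡ modify A (top b h) δ
    updAt-root b h A rewrite ≡ᵇ-refl (top b h) = ≡.refl

    childRoot : ℕ → ℕ → ℕ → ℕ
    childRoot i b h = if i ≤ᵇ top b h then top b h else top (top b h) h

    updAt-suc : ∀ {i b h A} → top b (suc h) ≢ i →
                updAt i b (suc h) A ≡
                accumulateRoot b h (upd N i δ h (childRoot i b h) (unaccumulateRoot b h A))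
    updAt-suc {i} {b} {h} {A} c≢i rewrite ≢⇒≡ᵇ≡false c≢i =
      ≡.cong₂ (λ l r → accumulate l r c (upd N i δ h (if i ≤ᵇ l then l else r)
                                                   (unaccumulate l r c A)))
              (top-suc∸2^ b h) (top-suc∸1 b h)
      where c = top b (suc h)

    childRoot-left : ∀ {i b h} → InTree b h i → childRoot i b h ≡ top b h
    childRoot-left i∈ rewrite ≤⇒≤ᵇ≡true (InTree.upper i∈) = ≡.refl

    childRoot-right : ∀ {i b h} → InTree (top b h) h i → childRoot i b h ≡ top (top b h) h
    childRoot-right i∈ rewrite >⇒≤ᵇ≡false (InTree.lower i∈) = ≡.refl

    updAt-left : ∀ {i b h A} → InTree b h i →
                 updAt i b (suc h) A ≡ accumulateRoot b h (updAt i b h (unaccumulateRoot b h A))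
    updAt-left {i} {b} {h} {A} i∈ =
      ≡.trans (updAt-suc (>⇒≢ (left<root i∈)))
              (≡.cong (λ c → accumulateRoot b h (upd N i δ h c (unaccumulateRoot b h A)))
                      (childRoot-left i∈))

    updAt-right : ∀ {i b h A} → InTree (top b h) h i →
                  updAt i b (suc h) A ≡ accumulateRoot b h (updAt i (top b h) h (unaccumulateRoot b h A))
    updAt-right {i} {b} {h} {A} i∈ =
      ≡.trans (updAt-suc (>⇒≢ (right<root i∈)))
              (≡.cong (λ c → accumulateRoot b h (upd N i δ h c (unaccumulateRoot b h A)))
                      (childRoot-right i∈))

    updAt-frame : ∀ h b {i A j} → InTree b h i → ¬ InTree b h j → updAt i b h A j ≡ A j
    updAt-frame zero    b i∈ _ = ⊥-elim (InTree-zero i∈)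
    updAt-frame (suc h) b {i} {A} {j} i∈ j∉ with position i∈
    ... | atRoot ≡.refl =
      ≡.trans (≡.cong-app (updAt-root b (suc h) A) j) (set-≢ A _ _ (∉⇒≢root j∉))
    ... | inLeft q =
      ≡.trans (≡.cong-app (updAt-left q) j)
      (≡.trans (accumulate-≢ _ _ _ (∉⇒≢root j∉))
      (≡.trans (updAt-frame h b q (λ p → j∉ (InTree-left p)))
               (unaccumulate-≢ _ _ A (∉⇒≢root j∉))))
    ... | inRight q =
      ≡.trans (≡.cong-app (updAt-right q) j)
      (≡.trans (accumulate-≢ _ _ _ (∉⇒≢root j∉))
      (≡.trans (updAt-frame h (top b h) q (λ p → j∉ (InTree-right p)))
               (unaccumulate-≢ _ _ A (∉⇒≢root j∉))))

    modify-above : ∀ B {i c} → i < c → B c ≈ modify B i δ c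
    modify-above B i<c = sym (reflexive (set-≢ B _ _ (>⇒≢ i<c)))

    UpdateCorrect : ℕ → ℕ → ℕ → Set (a ⊔ ℓ)
    UpdateCorrect i b h = ∀ {A B} → A ≈[ InTree b h ] buildAt b h B →
                          updAt i b h A ≈[ InTree b h ] buildAt b h (modify B i δ)

    updAt-correct-root : ∀ b h → UpdateCorrect (top b (suc h)) b (suc h)
    updAt-correct-root b zero {A} {B} A≈ {j} p = begin
      updAt (top b 1) b 1 A j   ≡⟨ ≡.cong-app (updAt-root b 1 A) j ⟩
      modify A (top b 1) δ j    ≈⟨ modify-cong InTree-root A≈ p ⟩
      modify B (top b 1) δ j    ∎
    updAt-correct-root b (suc k) {A} {B} A≈ {j} p = begin
      updAt c b (suc (suc k)) A j                   ≡⟨ ≡.cong-app (updAt-root b (suc (suc k)) A) j ⟩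
      modify A c δ j                                ≈⟨ modify-cong InTree-root A≈′ p ⟩
      modify (accumulateRoot b (suc k) C) c δ j     ≈⟨ accumulate-modify C δ (<⇒≢ (leftRoot<root b (suc k)))
                                                                             (<⇒≢ (rightRoot<root b (suc k))) j ⟩
      accumulateRoot b (suc k) (modify C c δ) j     ≈⟨ accumulateRoot-cong {b} {k} children-modify p ⟨
      accumulateRoot b (suc k) (children b (suc k) B′) j
                                                    ≡⟨ ≡.cong-app (buildAt-suc-suc b k B′) j ⟨
      buildAt b (suc (suc k)) B′ j                  ∎
      where
      c  = top b (suc (suc k))
      C  = children b (suc k) B
      B′ = modify B c δ

      A≈′ : A ≈[ InTree b (suc (suc k)) ] accumulateRoot b (suc k) C
      A≈′ q = trans (A≈ q) (reflexive (≡.cong-app (buildAt-suc-suc b k B) _))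

      children-modify : children b (suc k) B′ ≈[ InTree b (suc (suc k)) ] modify C c δ
      children-modify q with position q
      ... | inLeft q′  = trans (children-cong-left (modify-outside {B = B} c∉left) q′)
                               (sym (modify-outside {B = C} c∉left q′))
        where c∉left = root∉left {b} {suc k}
      ... | inRight q′ = trans (children-cong-right (modify-outside {B = B} c∉right) q′)
                               (sym (modify-outside {B = C} c∉right q′))
        where c∉right = root∉right {b} {suc k}
      ... | atRoot ≡.refl = begin
        children b (suc k) B′ c   ≡⟨ children-root b (suc k) B′ ⟩
        B′ c                      ≡⟨ set-≡ B c _ ⟩
        B c ∙ δ                   ≡⟨ ≡.cong (_∙ δ) (children-root b (suc k) B) ⟨
        C c ∙ δ                   ≡⟨ set-≡ C c _ ⟨
        modify C c δ c            ∎

    updAt-correct-left : ∀ {i b h} → InTree b h i → UpdateCorrect i b h → UpdateCorrect i b (suc h)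
    updAt-correct-left {h = zero} i∈ _ = ⊥-elim (InTree-zero i∈)
    updAt-correct-left {i} {b} {suc k} i∈ ih {A} {B} A≈ {j} p = begin
      updAt i b (suc (suc k)) A j                          ≡⟨ ≡.cong-app (updAt-left i∈) j ⟩
      accumulateRoot b (suc k) (updAt i b (suc k) A₁) j    ≈⟨ accumulateRoot-cong {b} {k} agree p ⟩
      accumulateRoot b (suc k) (children b (suc k) B′) j   ≡⟨ ≡.cong-app (buildAt-suc-suc b k B′) j ⟨
      buildAt b (suc (suc k)) B′ j                         ∎
      where
      A₁ = unaccumulateRoot b (suc k) A
      B′ = modify B i δ

      A₁≈ : A₁ ≈[ InTree b (suc (suc k)) ] children b (suc k) B
      A₁≈ = unaccumulateRoot-buildAt A≈

      agree : updAt i b (suc k) A₁ ≈[ InTree b (suc (suc k)) ] children b (suc k) B′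
      agree {x} q with position q
      ... | inLeft q′ = begin
        updAt i b (suc k) A₁ x     ≈⟨ ih (λ r → trans (A₁≈ (InTree-left r)) (reflexive (children-left r)))
                                         q′ ⟩
        buildAt b (suc k) B′ x     ≡⟨ children-left q′ ⟨
        children b (suc k) B′ x    ∎
      ... | inRight q′ = begin
        updAt i b (suc k) A₁ x     ≡⟨ updAt-frame (suc k) b i∈ (λ r → left∩right r q′) ⟩
        A₁ x                       ≈⟨ A₁≈ q ⟩
        children b (suc k) B x     ≈⟨ children-cong-right (λ r → sym (modify-outside (left∩right i∈) r))
                                                          q′ ⟩
        children b (suc k) B′ x    ∎
      ... | atRoot ≡.refl = begin
        updAt i b (suc k) A₁ x     ≡⟨ updAt-frame (suc k) b i∈ root∉left ⟩
        A₁ x                       ≈⟨ A₁≈ q ⟩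
        children b (suc k) B x     ≈⟨ children-cong-root b (suc k) B B′ (modify-above B (left<root i∈)) ⟩
        children b (suc k) B′ x    ∎

    updAt-correct-right : ∀ {i b h} → InTree (top b h) h i → UpdateCorrect i (top b h) h →
                          UpdateCorrect i b (suc h)
    updAt-correct-right {h = zero} i∈ _ = ⊥-elim (InTree-zero i∈)
    updAt-correct-right {i} {b} {suc k} i∈ ih {A} {B} A≈ {j} p = begin
      updAt i b (suc (suc k)) A j                          ≡⟨ ≡.cong-app (updAt-right i∈) j ⟩
      accumulateRoot b (suc k) (updAt i R (suc k) A₁) j    ≈⟨ accumulateRoot-cong {b} {k} agree p ⟩
      accumulateRoot b (suc k) (children b (suc k) B′) j   ≡⟨ ≡.cong-app (buildAt-suc-suc b k B′) j ⟨
      buildAt b (suc (suc k)) B′ j                         ∎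
      where
      R  = top b (suc k)
      A₁ = unaccumulateRoot b (suc k) A
      B′ = modify B i δ

      A₁≈ : A₁ ≈[ InTree b (suc (suc k)) ] children b (suc k) B
      A₁≈ = unaccumulateRoot-buildAt A≈

      L = buildAt b (suc k)

      i∉left : ¬ InTree b (suc k) i
      i∉left p′ = left∩right p′ i∈

      modify-commutes : modify (L B) i δ ≈[ InTree R (suc k) ] L B′
      modify-commutes r = trans (modify-cong i∈ (buildAt-fixes-right {b} {suc k} {B}) r)
                                (sym (buildAt-fixes-right {b} {suc k} {B′} r))

      agree : updAt i R (suc k) A₁ ≈[ InTree b (suc (suc k)) ] children b (suc k) B′
      agree {x} q with position q
      ... | inRight q′ = begin
        updAt i R (suc k) A₁ x                       ≈⟨ ih {B = L B} (λ r → A₁≈ (InTree-right r)) q′ ⟩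
        buildAt R (suc k) (modify (L B) i δ) x       ≈⟨ buildAt-cong (suc k) R modify-commutes q′ ⟩
        children b (suc k) B′ x                      ∎
      ... | inLeft q′ = begin
        updAt i R (suc k) A₁ x     ≡⟨ updAt-frame (suc k) R i∈ (left∩right q′) ⟩
        A₁ x                       ≈⟨ A₁≈ q ⟩
        children b (suc k) B x     ≈⟨ children-cong-left (λ r → sym (modify-outside i∉left r)) q′ ⟩
        children b (suc k) B′ x    ∎
      ... | atRoot ≡.refl = begin
        updAt i R (suc k) A₁ x     ≡⟨ updAt-frame (suc k) R i∈ root∉right ⟩
        A₁ x                       ≈⟨ A₁≈ q ⟩
        children b (suc k) B x     ≈⟨ children-cong-root b (suc k) B B′ (modify-above B (right<root i∈)) ⟩
        children b (suc k) B′ x    ∎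

    updAt-correct : ∀ h b i → InTree b h i → UpdateCorrect i b h
    updAt-correct zero    b i i∈ = ⊥-elim (InTree-zero i∈)
    updAt-correct (suc h) b i i∈ with position i∈
    ... | inLeft q      = updAt-correct-left q (updAt-correct h b i q)
    ... | inRight q     = updAt-correct-right q (updAt-correct h (top b h) i q)
    ... | atRoot ≡.refl = updAt-correct-root b h

  build≡buildAt : ∀ I → build N I ≡ buildAt 0 (rootHeight N) I
  build≡buildAt I = ≡.cong (λ c → buildNode N (rootHeight N) c I) (2^h∸1≡treeSize (rootHeight N))

  update≡updAt : ∀ i δ A → update N i δ A ≡ updAt δ i 0 (rootHeight N) A
  update≡updAt i δ A = ≡.cong (λ c → upd N i δ (rootHeight N) c A) (2^h∸1≡treeSize (rootHeight N))

theorem2 : ∀ {c ℓ : Level} (G : Group c ℓ) →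
    (N : ℕ) → 1 ≤ N → (I : ℕ → Group.Carrier G) → (i : ℕ) → 1 ≤ i → i ≤ N →
    (δ : Group.Carrier G) → ∀ j → 1 ≤ j → j ≤ N →
      Group._≈_ G (SouthwestTree.update G N i δ (SouthwestTree.build G N I) j)
                  (SouthwestTree.build G N (SouthwestTree.modify G I i δ) j)
theorem2 G N _ I i 1≤i i≤N δ j 1≤j j≤N = begin
  update N i δ (build N I) j     ≡⟨ ≡.cong-app (update≡updAt i δ (build N I)) j ⟩
  updAt δ i 0 H (build N I) j    ≈⟨ updAt-correct δ H 0 i (InTree-log₂ 1≤i i≤N)
                                      (λ _ → reflexive (≡.cong-app (build≡buildAt I) _))
                                      (InTree-log₂ 1≤j j≤N) ⟩
  buildAt 0 H (modify I i δ) j   ≡⟨ ≡.cong-app (build≡buildAt (modify I i δ)) j ⟨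
  build N (modify I i δ) j       ∎
  where
  open Group G
  open SouthwestTree G
  open SouthwestTreeUpdate G N
  open import Relation.Binary.Reasoning.Setoid setoid
  H = rootHeight N
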